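{- For every partial graph $\gamma$ and nodes $x,y$: (1) $\mathit{reach}\ \gamma\ x=\mathit{reach}\ \lfloor\gamma\rfloor\ x$; (2) if $y\notin\mathit{reach}\ \gamma\ x$, then $\mathit{reach}\ \gamma\ x=\mathit{reach}\ (\gamma\setminus y)\ x$; (3) if $y\in\mathit{reach}\ \gamma\ x$, then $\mathit{reach}\ \gamma\ x=\mathit{reach}\ (\gamma\setminus y)\ x\cup\mathit{reach}\ \gamma\ y$.
   Context: A partial graph of type $T$ is a finite partial map $\gamma$ from nodes (natural numbers, undefined at $0$) to $T\times\mathrm{seq}(\mathrm{node})$; $\mathit{nodes}\ \gamma$ is its domain, $\gamma_{adj}\,x$ is the adjacency list of $x$ (entries need not be nodes of $\gamma$). $\gamma\setminus y$ is $\gamma$ restricted to $\mathit{nodes}\ \gamma\setminus\{y\}$. Erasure $\lfloor\gamma\rfloor$ maps each $x\in\mathit{nodes}\ \gamma$ to (unit contents and) $\gamma_{adj}\,x$. Reachability: $\mathit{reach}\ \gamma\ x=\{x\}\cup\bigcup_{z\in\gamma_{adj}x}\mathit{reach}\ (\gamma\setminus x)\ z$ if $x\in\mathit{nodes}\ \gamma$, and $\emptyset$ otherwise. -}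

module Defs where

open import Data.Nat using (ℕ; zero; suc; _≤_; _≟_)
open import Data.Maybe using (Maybe; just; nothing)
open import Data.List using (List)
open import Data.List.Relation.Unary.Any using (Any)
open import Data.Product using (_×_; _,_)
open import Data.Unit using (⊤; tt)
open import Data.Empty using (⊥)
open import Data.Sum using (_⊎_)
open import Relation.Nullary using (yes; no)
open import Relation.Binary.PropositionalEquality using (_≡_)
open import Relation.Unary using (Pred)
open import Level using (0ℓ)

Node : Set
Node = ℕ

-- A partial graph of type T: a finite partial map from nodes to
-- (contents , adjacency list).  Finiteness is witnessed by a bound beyond
-- which the map is undefined; the map is undefined at 0.
record PGraph (T : Set) : Set where
  constructor pgraph
  field
    lookup   : Node → Maybe (T × List Node)
    bound    : ℕ
    finite   : ∀ x → bound ≤ x → lookup x ≡ nothing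
    undef0   : lookup 0 ≡ nothing
open PGraph public

_∈nodes_ : {T : Set} → Node → PGraph T → Set
x ∈nodes γ = Any-just (lookup γ x)
  where
  Any-just : {A : Set} → Maybe A → Set
  Any-just nothing  = ⊥
  Any-just (just _) = ⊤

restrictLookup : {T : Set} → (Node → Maybe (T × List Node)) → Node → Node → Maybe (T × List Node)
restrictLookup f y x with x ≟ y
... | yes _ = nothing
... | no  _ = f x

_∖_ : {T : Set} → PGraph T → Node → PGraph T
γ ∖ y = record
  { lookup = restrictLookup (lookup γ) y
  ; bound  = bound γ
  ; finite = fin
  ; undef0 = u0
  }
  where
  fin : ∀ x → bound γ ≤ x → restrictLookup (lookup γ) y x ≡ nothing
  fin x b with x ≟ y
  ... | yes _ = Relation.Binary.PropositionalEquality.refl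
  ... | no  _ = finite γ x b
  u0 : restrictLookup (lookup γ) y 0 ≡ nothing
  u0 with 0 ≟ y
  ... | yes _ = Relation.Binary.PropositionalEquality.refl
  ... | no  _ = undef0 γ

eraseEntry : {T : Set} → Maybe (T × List Node) → Maybe (⊤ × List Node)
eraseEntry nothing          = nothing
eraseEntry (just (_ , adj)) = just (tt , adj)

⌊_⌋ : {T : Set} → PGraph T → PGraph ⊤
⌊ γ ⌋ = record
  { lookup = λ x → eraseEntry (lookup γ x)
  ; bound  = bound γ
  ; finite = λ x b → Relation.Binary.PropositionalEquality.cong eraseEntry (finite γ x b)
  ; undef0 = Relation.Binary.PropositionalEquality.cong eraseEntry (undef0 γ)
  }

-- reach γ x = {x} ∪ ⋃_{z ∈ γ_adj x} reach (γ ∖ x) z   if x ∈ nodes γ,  ∅ otherwise.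
-- Implemented with fuel; the fuel  bound γ  always suffices, since every
-- recursive call removes a node of γ, and γ has fewer than  bound γ  nodes.
reachEntry : {T : Set} → (PGraph T → Node → Pred Node 0ℓ) →
             PGraph T → Node → Maybe (T × List Node) → Pred Node 0ℓ
reachEntry r γ x nothing          w = ⊥
reachEntry r γ x (just (_ , adj)) w = w ≡ x ⊎ Any (λ z → r (γ ∖ x) z w) adj

reachFuel : {T : Set} → ℕ → PGraph T → Node → Pred Node 0ℓ
reachFuel zero    γ x w = ⊥
reachFuel (suc n) γ x w = reachEntry (reachFuel n) γ x (lookup γ x) w

reach : {T : Set} → PGraph T → Node → Pred Node 0ℓ
reach γ x = reachFuel (bound γ) γ x

{-# OPTIONS --safe #-}
-- reach γ x is exactly the set of nodes reachable from x by a walk in γ.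
-- A walk from x can be shortened to one that leaves x along an edge
-- x → z and never returns, i.e. continues in γ ∖ x, which is the recursion
-- defining reach; the fuel  bound γ  suffices because it exceeds the number of
-- nodes of γ, and deleting a node decreases that number.  For walks, (1) holds
-- because erasure keeps the adjacency lists, and (2) and (3) follow by cutting
-- a walk at its last visit to y.
module Submission where

open import Defs
open import Data.Product using (_×_)
open import Relation.Unary using (_≐_; _∪_; _∈_; _∉_)

open import Level using (Level)
open import Relation.Unary using (Pred)
open import Data.Nat using (ℕ; zero; suc; _+_; _≤_; _<_; _≟_; z≤n; s≤s; s≤s⁻¹)
open import Data.Nat.Properties
  using (≤-refl; ≤-reflexive; ≤-trans; ≤∧≢⇒<; n≤1+n; <-irrefl; +-mono-≤; +-monoʳ-<; <-≤-trans; _≤?_; ≰⇒>)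
open import Data.Maybe using (Maybe; just; nothing)
open import Data.List using (List)
open import Data.List.Membership.Propositional using (find; lose) renaming (_∈_ to _∈ˡ_)
open import Data.Product using (Σ; _,_; proj₁; proj₂)
open import Data.Empty using (⊥-elim)
open import Data.Unit using (tt)
open import Data.Sum using (_⊎_; inj₁; inj₂)
import Data.Sum as Sum
open import Function using (_∘_; id)
open import Relation.Nullary using (¬_; yes; no)
open import Relation.Unary.Properties using (≐-sym; ≐-trans)
open import Relation.Binary.PropositionalEquality using (_≡_; _≢_; refl; sym; trans; cong)

module _ {a ℓ : Level} {A : Set a} {P P′ Q Q′ : Pred A ℓ} where

  ∪-cong : P ≐ P′ → Q ≐ Q′ → (P ∪ Q) ≐ (P′ ∪ Q′)
  ∪-cong (P⊆P′ , P′⊆P) (Q⊆Q′ , Q′⊆Q) = Sum.map P⊆P′ Q⊆Q′ , Sum.map P′⊆P Q′⊆Q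

  ≐-resp-≐ : P ≐ P′ → Q ≐ Q′ → P′ ≐ Q′ → P ≐ Q
  ≐-resp-≐ P≐P′ Q≐Q′ P′≐Q′ = ≐-trans P≐P′ (≐-trans P′≐Q′ (≐-sym Q≐Q′))

module _ {A : Set} where

  countJust : Maybe A → ℕ
  countJust nothing  = 0
  countJust (just _) = 1

  countDefined : (Node → Maybe A) → ℕ → ℕ
  countDefined f zero    = 0
  countDefined f (suc k) = countJust (f k) + countDefined f k

  countJust≤1 : (m : Maybe A) → countJust m ≤ 1
  countJust≤1 nothing  = z≤n
  countJust≤1 (just _) = s≤s z≤n

  countDefined-≤ : (f : Node → Maybe A) → f 0 ≡ nothing → (k : ℕ) → countDefined f (suc k) ≤ k
  countDefined-≤ f f0≡nothing zero    rewrite f0≡nothing = z≤n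
  countDefined-≤ f f0≡nothing (suc k) =
    +-mono-≤ (countJust≤1 (f (suc k))) (countDefined-≤ f f0≡nothing k)

module _ {T : Set} where

  restrictLookup-≢ : (f : Node → Maybe (T × List Node)) {x y : Node} →
                     x ≢ y → restrictLookup f y x ≡ f x
  restrictLookup-≢ f {x} {y} x≢y with x ≟ y
  ... | yes x≡y = ⊥-elim (x≢y x≡y)
  ... | no _    = refl

  restrictLookup-self : (f : Node → Maybe (T × List Node)) (y : Node) →
                        restrictLookup f y y ≡ nothing
  restrictLookup-self f y with y ≟ y
  ... | yes _   = refl
  ... | no y≢y  = ⊥-elim (y≢y refl)

  restrictLookup-just : (f : Node → Maybe (T × List Node)) {x y : Node} {e : T × List Node} →
                        restrictLookup f y x ≡ just e → f x ≡ just e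
  restrictLookup-just f {x} {y} eq with x ≟ y
  restrictLookup-just f () | yes _
  restrictLookup-just f eq | no _  = eq

  countDefined-restrict-≥ : (f : Node → Maybe (T × List Node)) {x : Node} (k : ℕ) → k ≤ x →
                            countDefined (restrictLookup f x) k ≡ countDefined f k
  countDefined-restrict-≥ f zero    _   = refl
  countDefined-restrict-≥ f (suc k) k<x
    rewrite restrictLookup-≢ f (λ k≡x → <-irrefl k≡x k<x)
          | countDefined-restrict-≥ f k (≤-trans (n≤1+n k) k<x) = refl

  countDefined-restrict-< : (f : Node → Maybe (T × List Node)) {x : Node} {e : T × List Node} →
                            f x ≡ just e → (k : ℕ) → x < k →
                            countDefined (restrictLookup f x) k < countDefined f k
  countDefined-restrict-< f {x} fx (suc k) (s≤s x≤k) with x ≟ k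
  ... | yes refl rewrite restrictLookup-self f x | fx =
    s≤s (≤-reflexive (countDefined-restrict-≥ f x ≤-refl))
  ... | no x≢k rewrite restrictLookup-≢ f (x≢k ∘ sym) =
    +-monoʳ-< (countJust (f k)) (countDefined-restrict-< f fx k (≤∧≢⇒< x≤k x≢k))

  size : PGraph T → ℕ
  size γ = countDefined (lookup γ) (bound γ)

  defined⇒<bound : (γ : PGraph T) {x : Node} → lookup γ x ≢ nothing → x < bound γ
  defined⇒<bound γ {x} defined with bound γ ≤? x
  ... | yes bound≤x = ⊥-elim (defined (finite γ x bound≤x))
  ... | no  bound≰x = ≰⇒> bound≰x

  size<bound : (γ : PGraph T) {x : Node} → lookup γ x ≢ nothing → size γ < bound γ
  size<bound γ defined with bound γ | defined⇒<bound γ defined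
  ... | suc b | _ = s≤s (countDefined-≤ (lookup γ) (undef0 γ) b)

  size-∖ : (γ : PGraph T) {x : Node} {e : T × List Node} → lookup γ x ≡ just e → size (γ ∖ x) < size γ
  size-∖ γ {x} eq = countDefined-restrict-< (lookup γ) eq (bound γ) (defined⇒<bound γ defined)
    where
    defined : lookup γ x ≢ nothing
    defined rewrite eq = λ ()

data Walk {T : Set} (γ : PGraph T) : Node → Node → Set where
  here : ∀ {x t adj} → lookup γ x ≡ just (t , adj) → Walk γ x x
  step : ∀ {x z w t adj} → lookup γ x ≡ just (t , adj) → z ∈ˡ adj → Walk γ z w → Walk γ x w

data Leaving {T : Set} (γ : PGraph T) (y : Node) : Node → Set where
  stay  : ∀ {t adj} → lookup γ y ≡ just (t , adj) → Leaving γ y y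
  leave : ∀ {z w t adj} → lookup γ y ≡ just (t , adj) → z ∈ˡ adj → Walk (γ ∖ y) z w → Leaving γ y w

module _ {T : Set} where

  source-defined : {γ : PGraph T} {x w : Node} → Walk γ x w → lookup γ x ≢ nothing
  source-defined (here eq)     rewrite eq = λ ()
  source-defined (step eq _ _) rewrite eq = λ ()

  Walk-∖⇒Walk : {γ : PGraph T} {y x w : Node} → Walk (γ ∖ y) x w → Walk γ x w
  Walk-∖⇒Walk {γ} (here eq)      = here (restrictLookup-just (lookup γ) eq)
  Walk-∖⇒Walk {γ} (step eq z∈ p) = step (restrictLookup-just (lookup γ) eq) z∈ (Walk-∖⇒Walk p)

  Walk-++ : {γ : PGraph T} {x y w : Node} → Walk γ x y → Walk γ y w → Walk γ x w
  Walk-++ (here _)       q = q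
  Walk-++ (step eq z∈ p) q = step eq z∈ (Walk-++ p q)

  Leaving⇒Walk : {γ : PGraph T} {y w : Node} → Leaving γ y w → Walk γ y w
  Leaving⇒Walk (stay eq)       = here eq
  Leaving⇒Walk (leave eq z∈ q) = step eq z∈ (Walk-∖⇒Walk q)

  lastVisit : {γ : PGraph T} {y x w : Node} → Walk γ x w →
              Walk (γ ∖ y) x w ⊎ (Walk γ x y × Leaving γ y w)
  lastVisit {γ} {y} {x} (here eq) with x ≟ y
  ... | yes refl = inj₂ (here eq , stay eq)
  ... | no x≢y   = inj₁ (here (trans (restrictLookup-≢ (lookup γ) x≢y) eq))
  lastVisit {γ} {y} {x} (step eq z∈ p) with lastVisit {y = y} p
  ... | inj₂ (p₁ , l) = inj₂ (step eq z∈ p₁ , l)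
  ... | inj₁ q with x ≟ y
  ...   | yes refl = inj₂ (here eq , leave eq z∈ q)
  ...   | no x≢y   = inj₁ (step (trans (restrictLookup-≢ (lookup γ) x≢y) eq) z∈ q)

  Walk⇒Leaving : {γ : PGraph T} {x w : Node} → Walk γ x w → Leaving γ x w
  Walk⇒Leaving {γ} {x} p with lastVisit {y = x} p
  ... | inj₁ q       = ⊥-elim (source-defined q (restrictLookup-self (lookup γ) x))
  ... | inj₂ (_ , l) = l

  Walk-∖-unreachable : {γ : PGraph T} {x y : Node} → ¬ Walk γ x y → Walk γ x ≐ Walk (γ ∖ y) x
  Walk-∖-unreachable ¬x⇝y = (λ p → Sum.[ id , ⊥-elim ∘ ¬x⇝y ∘ proj₁ ]′ (lastVisit p)) , Walk-∖⇒Walk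

  Walk-∖-reachable : {γ : PGraph T} {x y : Node} → Walk γ x y →
                     Walk γ x ≐ (Walk (γ ∖ y) x ∪ Walk γ y)
  Walk-∖-reachable x⇝y = (λ p → Sum.map₂ (Leaving⇒Walk ∘ proj₂) (lastVisit p))
                       , Sum.[ Walk-∖⇒Walk , Walk-++ x⇝y ]′

  eraseEntry-just : (m : Maybe (T × List Node)) {adj : List Node} →
                    eraseEntry m ≡ just (tt , adj) → Σ T λ t → m ≡ just (t , adj)
  eraseEntry-just (just (t , _)) refl = t , refl

  Walk⇒Walk-⌊⌋ : {γ : PGraph T} {x w : Node} → Walk γ x w → Walk ⌊ γ ⌋ x w
  Walk⇒Walk-⌊⌋ (here eq)      = here (cong eraseEntry eq)
  Walk⇒Walk-⌊⌋ (step eq z∈ p) = step (cong eraseEntry eq) z∈ (Walk⇒Walk-⌊⌋ p)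

  Walk-⌊⌋⇒Walk : {γ : PGraph T} {x w : Node} → Walk ⌊ γ ⌋ x w → Walk γ x w
  Walk-⌊⌋⇒Walk {γ} {x} (here eq)      = here (proj₂ (eraseEntry-just (lookup γ x) eq))
  Walk-⌊⌋⇒Walk {γ} {x} (step eq z∈ p) =
    step (proj₂ (eraseEntry-just (lookup γ x) eq)) z∈ (Walk-⌊⌋⇒Walk p)

  Walk-⌊⌋ : {γ : PGraph T} {x : Node} → Walk γ x ≐ Walk ⌊ γ ⌋ x
  Walk-⌊⌋ = Walk⇒Walk-⌊⌋ , Walk-⌊⌋⇒Walk

  reachFuel⇒Walk : (n : ℕ) {γ : PGraph T} {x w : Node} → reachFuel n γ x w → Walk γ x w
  reachFuel⇒Walk (suc n) {γ} {x} r with lookup γ x in eq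
  reachFuel⇒Walk (suc n) (inj₁ refl) | just _ = here eq
  reachFuel⇒Walk (suc n) (inj₂ r)    | just _ with z , z∈ , r′ ← find r =
    step eq z∈ (Walk-∖⇒Walk (reachFuel⇒Walk n r′))

  Walk⇒reachFuel : (n : ℕ) {γ : PGraph T} {x w : Node} → size γ < n → Walk γ x w → reachFuel n γ x w
  Walk⇒reachFuel (suc n) {γ} size<n p with Walk⇒Leaving p
  ... | stay eq rewrite eq = inj₁ refl
  ... | leave eq z∈ q rewrite eq =
    inj₂ (lose z∈ (Walk⇒reachFuel n (<-≤-trans (size-∖ γ eq) (s≤s⁻¹ size<n)) q))

  reach≐Walk : (γ : PGraph T) (x : Node) → reach γ x ≐ Walk γ x
  reach≐Walk γ x = reachFuel⇒Walk (bound γ)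
                 , λ p → Walk⇒reachFuel (bound γ) (size<bound γ (source-defined p)) p

lemma3p4 : {T : Set} (γ : PGraph T) (x y : Node) →
    (reach γ x ≐ reach ⌊ γ ⌋ x)
    × (y ∉ reach γ x → reach γ x ≐ reach (γ ∖ y) x)
    × (y ∈ reach γ x → reach γ x ≐ (reach (γ ∖ y) x ∪ reach γ y))
lemma3p4 γ x y =
    ≐-resp-≐ (reach≐Walk γ x) (reach≐Walk ⌊ γ ⌋ x) Walk-⌊⌋
  , (λ y∉ → ≐-resp-≐ (reach≐Walk γ x) (reach≐Walk (γ ∖ y) x)
                     (Walk-∖-unreachable (y∉ ∘ proj₂ (reach≐Walk γ x))))
  , (λ y∈ → ≐-resp-≐ (reach≐Walk γ x) (∪-cong (reach≐Walk (γ ∖ y) x) (reach≐Walk γ y))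
                     (Walk-∖-reachable (proj₁ (reach≐Walk γ x) y∈)))
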